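{- For all integers $i,d,k$, every incidence graph $G\in\mathscr{C}_d$, every $(i,d,k)$-obstruction-tree $T$ of $G$, every variable $x$ of $G$ and every polarity $\star\in\{+,-\}$: if $x\notin\mathrm{var}(T)$ and no clause $c\in\mathrm{cla}(T)$ is joined to $x$ by an edge of polarity $\star$, then $T$ is still an $(i,d,k)$-obstruction-tree of $G[x_\star]$.
   Context: CNF formulas are identified with incidence graphs: bipartite graphs on variables and clauses, with a positive edge $\{x,c\}$ if $x_+\in c$ and a negative edge if $x_-\in c$ (no clause contains both). $G[x_\star]$ is the incidence graph of the formula obtained by setting $x$ to $\star$: delete clauses containing $x_\star$ and delete the opposite literal of $x$ from the remaining clauses. The width of a clause is its number of variables; $\mathscr{C}_d$ is the class of formulas whose clauses all have width at most $d$; a $d$-clause has width exactly $d$. Let $\lambda_k=4\cdot 2^k$. For $G\in\mathscr{C}_d$, the $(i,d,k)$-obstruction-trees $T$ of $G$ ($i\ge d$), their element sets $V(T)$ (with clauses $\mathrm{cla}(T)$, variables $\mathrm{var}(T)$) and destroy-neighborhoods $N^\dagger_G(T)$ are defined inductively: (1) if $c$ is a $d$-clause of $G$ with variables $x_1,\dots,x_d$, then $T=\{c,x_1,\dots,x_d\}$ is a $(d,d,k)$-obstruction-tree, $V(T)=T$, $N^\dagger_G(T)=\{x_1,\dots,x_d\}$; (2) if $T_1,T_2$ are $(i,d,k)$-obstruction-trees of $G$ with $N^\dagger_G(T_1)\cap N^\dagger_G(T_2)=\emptyset$ and $P$ is a path in $G$ of length at most $\lambda_k$ connecting a vertex of $T_1$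 and a vertex of $T_2$, then $T=(T_1,P,T_2)$ is an $(i+1,d,k)$-obstruction-tree with $V(T)=V(T_1)\cup V(P)\cup V(T_2)$ and $N^\dagger_G(T)=\mathrm{var}(T)\cup\{x:\ \exists c_1,c_2\in\mathrm{cla}(T)\text{ with }\{x,c_1\}\text{ positive and }\{x,c_2\}\text{ negative edges}\}$. -}

module Defs where

open import Data.Nat using (ℕ; zero; suc; _+_; _*_; _^_; _≤_; _≡ᵇ_)
open import Data.Bool using (Bool; true; false; if_then_else_; not)
open import Data.Maybe using (Maybe; just; nothing)
open import Data.List using (List; []; _∷_; length; filterᵇ)
open import Data.List.Membership.Propositional using (_∈_)
open import Data.List.Relation.Unary.Unique.Propositional using (Unique)
open import Data.Product using (Σ; _×_; _,_; ∃)
open import Data.Sum using (_⊎_)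
open import Data.Empty using (⊥)
open import Relation.Binary.PropositionalEquality using (_≡_)
open import Function.Bundles using (_⇔_)

data Pol : Set where
  pos neg : Pol

_≟ᵖᵇ_ : Pol → Pol → Bool
pos ≟ᵖᵇ pos = true
neg ≟ᵖᵇ neg = true
_   ≟ᵖᵇ _   = false

isLit : Maybe Pol → Pol → Bool
isLit (just q) p = q ≟ᵖᵇ p
isLit nothing  p = false

-- Incidence graph of a CNF formula.  Variables and clauses are named by
-- natural numbers.  `edge c x` is the polarity of the edge {x,c} if any
-- (so no clause contains both x₊ and x₋).  Only edges between listed
-- vertices count (see Edge).
record CNF : Set where
  field
    vars    : List ℕ
    clauses : List ℕ
    edge    : ℕ → ℕ → Maybe Pol
open CNF public

Edge : CNF → ℕ → ℕ → Pol → Set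
Edge G c x p = (c ∈ clauses G) × (x ∈ vars G) × (edge G c x ≡ just p)

Occ : CNF → ℕ → ℕ → Set
Occ G c x = Σ Pol (Edge G c x)

VarsOf : CNF → ℕ → List ℕ → Set
VarsOf G c xs = Unique xs × (∀ x → Occ G c x ⇔ (x ∈ xs))

InC : ℕ → CNF → Set
InC d G = ∀ c → c ∈ clauses G → Σ (List ℕ) λ xs → VarsOf G c xs × (length xs ≤ d)

restrict : CNF → ℕ → Pol → CNF
restrict G x p = record
  { vars    = filterᵇ (λ y → not (y ≡ᵇ x)) (vars G)
  ; clauses = filterᵇ (λ c → not (isLit (edge G c x) p)) (clauses G)
  ; edge    = λ c y → if y ≡ᵇ x then nothing else edge G c y
  }

data Vertex : Set where
  var : ℕ → Vertex
  cla : ℕ → Vertex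

Adj : CNF → Vertex → Vertex → Set
Adj G (var x) (var y) = ⊥
Adj G (cla c) (cla e) = ⊥
Adj G (var x) (cla c) = Occ G c x
Adj G (cla c) (var x) = Occ G c x

-- Walk G a rest b : a ∷ rest is a walk in G from a to b
-- (its length, i.e. number of edges, is `length rest`).
data Walk (G : CNF) : Vertex → List Vertex → Vertex → Set where
  stop : ∀ {a} → Walk G a [] a
  step : ∀ {a v rest b} → Adj G a v → Walk G v rest b → Walk G a (v ∷ rest) b

Path : CNF → Vertex → List Vertex → Vertex → Set
Path G a rest b = Walk G a rest b × Unique (a ∷ rest)

λ[_] : ℕ → ℕ
λ[ k ] = 4 * 2 ^ k

data OT (G : CNF) (d k : ℕ) : ℕ → Set
V  : ∀ {G d k i} → OT G d k i → Vertex → Set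
N† : ∀ {G d k i} → OT G d k i → ℕ → Set

data OT G d k where
  leaf : (c : ℕ) → c ∈ clauses G → (xs : List ℕ) → VarsOf G c xs →
         length xs ≡ d → OT G d k d
  node : ∀ {i} (T₁ : OT G d k i) (T₂ : OT G d k i) →
         (∀ x → N† T₁ x → N† T₂ x → ⊥) →
         (a : Vertex) (rest : List Vertex) (b : Vertex) →
         Path G a rest b → length rest ≤ λ[ k ] →
         V T₁ a → V T₂ b → OT G d k (suc i)

V (leaf c _ xs _ _) (cla e) = e ≡ c
V (leaf c _ xs _ _) (var y) = y ∈ xs
V (node T₁ T₂ _ a rest b _ _ _ _) v = V T₁ v ⊎ v ∈ (a ∷ rest) ⊎ V T₂ v

N† (leaf c _ xs _ _) y = y ∈ xs
N† {G = G} T@(node _ _ _ _ _ _ _ _ _ _) y =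
  V T (var y) ⊎
  (Σ ℕ λ c₁ → Σ ℕ λ c₂ → V T (cla c₁) × V T (cla c₂) ×
     Edge G c₁ y pos × Edge G c₂ y neg)

-- The underlying (raw) tree of an obstruction tree, forgetting proofs;
-- used to say "T is still an obstruction tree" of another graph.
data RawTree : Set where
  rleaf : ℕ → List ℕ → RawTree
  rnode : RawTree → Vertex → List Vertex → Vertex → RawTree → RawTree

raw : ∀ {G d k i} → OT G d k i → RawTree
raw (leaf c _ xs _ _) = rleaf c xs
raw (node T₁ T₂ _ a rest b _ _ _ _) = rnode (raw T₁) a rest b (raw T₂)

{-# OPTIONS --safe #-}
module Submission where

open import Defs
open import Data.Nat using (ℕ; _≡ᵇ_; _≟_)
open import Data.Bool using (true; false; not; if_then_else_; T)
open import Data.Bool.Properties using (T-not-≡)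
open import Data.Maybe using (just; nothing)
open import Data.List using (_∷_)
open import Data.List.Membership.Propositional using (_∈_)
open import Data.List.Membership.Propositional.Properties using (∈-filter⁺; ∈-filter⁻)
open import Data.List.Relation.Unary.All as All using (All; _∷_)
open import Data.Product using (Σ; _,_; proj₁)
open import Data.Sum using (inj₁; inj₂)
open import Function.Bundles using (mk⇔; Equivalence)
open import Relation.Nullary using (¬_)
open import Relation.Nullary.Decidable using (T?; dec-false)
open import Relation.Binary.PropositionalEquality using (_≡_; _≢_; refl; trans; cong; cong₂)

-- Setting x to ⋆ keeps every vertex other than x and the clauses containing x_⋆,
-- keeps all edges among them and creates no new edges.  An obstruction tree avoiding
-- x and those clauses therefore survives verbatim: its leaves, paths and element sets
-- are unchanged, and its destroy-neighbourhoods can only shrink, so the disjointness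
-- required at each node is preserved.

record AgreesOn (Kept : Vertex → Set) (G H : CNF) : Set where
  field
    clause-kept : ∀ {c} → Kept (cla c) → c ∈ clauses G → c ∈ clauses H
    occ-kept    : ∀ {c y} → Kept (cla c) → Kept (var y) → Occ G c y → Occ H c y
    edge-reflected : ∀ {c y q} → Edge H c y q → Edge G c y q

module Transfer {Kept : Vertex → Set} {G H : CNF} (agrees : AgreesOn Kept G H) where
  open AgreesOn agrees

  occ-reflected : ∀ {c y} → Occ H c y → Occ G c y
  occ-reflected (q , e) = q , edge-reflected e

  adj-kept : ∀ {a b} → Kept a → Kept b → Adj G a b → Adj H a b
  adj-kept {var _} {cla _} ka kb = occ-kept kb ka
  adj-kept {cla _} {var _} ka kb = occ-kept ka kb

  walk-kept : ∀ {a rest b} → All Kept (a ∷ rest) → Walk G a rest b → Walk H a rest b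
  walk-kept _                   stop       = stop
  walk-kept (ka ∷ ks@(kv ∷ _)) (step a w) = step (adj-kept ka kv a) (walk-kept ks w)

  varsOf-kept : ∀ {c xs} → Kept (cla c) → (∀ {y} → y ∈ xs → Kept (var y)) →
                VarsOf G c xs → VarsOf H c xs
  varsOf-kept kc kxs (unique , occ⇔) = unique , λ y → mk⇔
    (λ o → Equivalence.to (occ⇔ y) (occ-reflected o))
    (λ y∈ → occ-kept kc (kxs y∈) (Equivalence.from (occ⇔ y) y∈))

  AllKept : ∀ {d k i} → OT G d k i → Set
  AllKept T = ∀ v → V T v → Kept v

  mutual
    transfer : ∀ {d k i} (T : OT G d k i) → AllKept T → OT H d k i
    transfer (leaf c c∈ xs vs len) kept =
      leaf c (clause-kept kc c∈) xs (varsOf-kept kc (kept (var _)) vs) len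
      where kc = kept (cla c) refl
    transfer (node T₁ T₂ disj a rest b (w , unique) len a∈ b∈) kept =
      node (transfer T₁ kept₁) (transfer T₂ kept₂)
           (λ y y∈₁ y∈₂ → disj y (N†-transfer⁻ T₁ kept₁ y∈₁) (N†-transfer⁻ T₂ kept₂ y∈₂))
           a rest b (walk-kept (All.tabulate λ v∈ → kept _ (inj₂ (inj₁ v∈))) w , unique) len
           (V-transfer⁺ T₁ kept₁ a∈) (V-transfer⁺ T₂ kept₂ b∈)
      where
      kept₁ : AllKept T₁
      kept₁ v v∈ = kept v (inj₁ v∈)
      kept₂ : AllKept T₂
      kept₂ v v∈ = kept v (inj₂ (inj₂ v∈))

    V-transfer⁺ : ∀ {d k i v} (T : OT G d k i) (kept : AllKept T) → V T v → V (transfer T kept) v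
    V-transfer⁺ {v = var _} (leaf _ _ _ _ _) _ v∈ = v∈
    V-transfer⁺ {v = cla _} (leaf _ _ _ _ _) _ v∈ = v∈
    V-transfer⁺ (node T₁ _ _ _ _ _ _ _ _ _) _ (inj₁ v∈) = inj₁ (V-transfer⁺ T₁ _ v∈)
    V-transfer⁺ (node _ _ _ _ _ _ _ _ _ _) _ (inj₂ (inj₁ v∈)) = inj₂ (inj₁ v∈)
    V-transfer⁺ (node _ T₂ _ _ _ _ _ _ _ _) _ (inj₂ (inj₂ v∈)) = inj₂ (inj₂ (V-transfer⁺ T₂ _ v∈))

    V-transfer⁻ : ∀ {d k i v} (T : OT G d k i) (kept : AllKept T) → V (transfer T kept) v → V T v
    V-transfer⁻ {v = var _} (leaf _ _ _ _ _) _ v∈ = v∈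
    V-transfer⁻ {v = cla _} (leaf _ _ _ _ _) _ v∈ = v∈
    V-transfer⁻ (node T₁ _ _ _ _ _ _ _ _ _) _ (inj₁ v∈) = inj₁ (V-transfer⁻ T₁ _ v∈)
    V-transfer⁻ (node _ _ _ _ _ _ _ _ _ _) _ (inj₂ (inj₁ v∈)) = inj₂ (inj₁ v∈)
    V-transfer⁻ (node _ T₂ _ _ _ _ _ _ _ _) _ (inj₂ (inj₂ v∈)) = inj₂ (inj₂ (V-transfer⁻ T₂ _ v∈))

    N†-transfer⁻ : ∀ {d k i y} (T : OT G d k i) (kept : AllKept T) → N† (transfer T kept) y → N† T y
    N†-transfer⁻ (leaf _ _ _ _ _) _ y∈ = y∈
    N†-transfer⁻ T@(node _ _ _ _ _ _ _ _ _ _) kept (inj₁ y∈) = inj₁ (V-transfer⁻ T kept y∈)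
    N†-transfer⁻ T@(node _ _ _ _ _ _ _ _ _ _) kept (inj₂ (c₁ , c₂ , c₁∈ , c₂∈ , e₁ , e₂)) =
      inj₂ (c₁ , c₂ , V-transfer⁻ T kept c₁∈ , V-transfer⁻ T kept c₂∈ ,
            edge-reflected e₁ , edge-reflected e₂)

  raw-transfer : ∀ {d k i} (T : OT G d k i) (kept : AllKept T) → raw (transfer T kept) ≡ raw T
  raw-transfer (leaf _ _ _ _ _) _ = refl
  raw-transfer (node T₁ T₂ _ a rest b _ _ _ _) _ =
    cong₂ (λ r₁ r₂ → rnode r₁ a rest b r₂) (raw-transfer T₁ _) (raw-transfer T₂ _)

isLit-true⇒≡just : ∀ m p → T (isLit m p) → m ≡ just p
isLit-true⇒≡just (just pos) pos _ = refl
isLit-true⇒≡just (just neg) neg _ = refl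

Avoids : CNF → ℕ → Pol → Vertex → Set
Avoids G x p (var y) = y ≢ x
Avoids G x p (cla c) = ¬ Edge G c x p

module _ {G : CNF} {x : ℕ} {p : Pol} where

  -- `does (y ≟ x)` computes to `y ≡ᵇ x`, the test used by `restrict`.
  edge-restrict : ∀ {c y} → y ≢ x → edge (restrict G x p) c y ≡ edge G c y
  edge-restrict {c} {y} y≢x =
    cong (λ b → if b then nothing else edge G c y) (dec-false (y ≟ x) y≢x)

  ∈-vars-restrict : ∀ {y} → y ≢ x → y ∈ vars G → y ∈ vars (restrict G x p)
  ∈-vars-restrict {y} y≢x y∈ = ∈-filter⁺ (λ z → T? (not (z ≡ᵇ x))) y∈
    (Equivalence.from T-not-≡ (dec-false (y ≟ x) y≢x))

  ∈-clauses-restrict : ∀ {c} → x ∈ vars G → ¬ Edge G c x p →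
                       c ∈ clauses G → c ∈ clauses (restrict G x p)
  ∈-clauses-restrict {c} x∈ c↛x c∈ = ∈-filter⁺ (λ e → T? (not (isLit (edge G e x) p))) c∈
    (Equivalence.from T-not-≡ (dec-false (T? (isLit (edge G c x) p))
      (λ lit → c↛x (c∈ , x∈ , isLit-true⇒≡just _ p lit))))

  edge-restrict⁻ : ∀ {c y q} → Edge (restrict G x p) c y q → Edge G c y q
  edge-restrict⁻ {y = y} (c∈ , y∈ , e) with y ≡ᵇ x
  edge-restrict⁻ (_ , _ , ()) | true
  ... | false = proj₁ (∈-filter⁻ _ c∈) , proj₁ (∈-filter⁻ _ y∈) , e

  restrict-agrees : x ∈ vars G → AgreesOn (Avoids G x p) G (restrict G x p)
  restrict-agrees x∈ = record
    { clause-kept    = ∈-clauses-restrict x∈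
    ; occ-kept       = λ c↛x y≢x (q , c∈ , y∈ , e) →
        q , ∈-clauses-restrict x∈ c↛x c∈ , ∈-vars-restrict y≢x y∈ , trans (edge-restrict y≢x) e
    ; edge-reflected = edge-restrict⁻
    }

propositionA1 : (i d k : ℕ) (G : CNF) → InC d G → (T : OT G d k i) →
    (x : ℕ) → x ∈ vars G → (p : Pol) →
    ¬ V T (var x) → (∀ c → V T (cla c) → ¬ Edge G c x p) →
    Σ (OT (restrict G x p) d k i) (λ T′ → raw T′ ≡ raw T)
propositionA1 i d k G _ T x x∈G p x∉T T↛x = transfer T kept , raw-transfer T kept
  where
  open Transfer (restrict-agrees x∈G)
  kept : AllKept T
  kept (var y) y∈T refl = x∉T y∈T
  kept (cla c) c∈T      = T↛x c c∈T
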